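{- Let $({\cal F},\tau)$ be an oriented Fano plane, $\epsilon^\tau$ its canonical composition factor and ${\cal I}_{\epsilon^\tau}=\{g\in\mathrm{Aut}({\cal F}):g\cdot\epsilon^\tau=\epsilon^\tau\}$, with $\delta^\ast$ computed using $\epsilon^\tau$. (1) If $g\in{\cal I}_{\epsilon^\tau}$ then $\delta^\ast(g,D)=1$ for all lines $D$. (2) If $g\in{\cal I}_{\epsilon^\tau}$ and $h\in\mathrm{Aut}({\cal F})$ then $\delta^\ast(gh,D)=\delta^\ast(h,D)$ and $\delta^\ast(hg,D)=\delta^\ast(h,g(D))$ for all lines $D$.
   Context: ${\cal F}$ is a Fano plane (seven points, seven lines); $\mathrm{Aut}({\cal F})$ is the group of bijections sending lines to lines, with composition $(gh)(P)=g(h(P))$. An orientation is $\tau\in\mathrm{Aut}({\cal F})$ of order seven. The canonical composition factor: fix $P_0$, and for $R=\tau^i(P_0)$, $S=\tau^j(P_0)$ distinct, $\epsilon^\tau_{RS}=1$ if $j-i\equiv1,2,4\pmod7$ and $-1$ if $j-i\equiv3,5,6\pmod7$ (independent of $P_0$). The action on such functions is $(g\cdot\epsilon)_{PQ}=\epsilon_{g^{ -1}(P)\,g^{ -1}(Q)}$. For $g\in\mathrm{Aut}({\cal F})$ and a line $D$, $\delta^\ast(g,D)=\epsilon^\tau_{PQ}\epsilon^\tau_{g(P)g(Q)}$ for any two distinct $P,Q\in D$ (independent of the choice). -}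

module Defs where

open import Data.Nat using (ℕ; zero; suc; _+_; _∸_; _%_)
open import Data.Fin using (Fin; toℕ) renaming (zero to fzero)
open import Data.Fin.Properties using (any?; _≟_)
open import Data.Fin.Subset using (Subset; _∈_; ∣_∣)
open import Data.Fin.Permutation using (Permutation′; _⟨$⟩ʳ_; _⟨$⟩ˡ_; _∘ₚ_)
open import Data.Vec using (tabulate; lookup; toList)
open import Data.List using (List; []; _∷_; allFin; filterᵇ)
open import Data.Bool using (Bool; true; false)
open import Data.Sign using (Sign; _*_) renaming (+ to pos; - to neg)
open import Data.Product using (Σ; ∃; _×_; _,_; proj₁)
open import Relation.Binary.PropositionalEquality using (_≡_; _≢_)
open import Relation.Nullary using (yes; no)

Point : Set
Point = Fin 7

record FanoPlane : Set where
  field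
    Line       : Fin 7 → Subset 7
    line-inj   : ∀ i j → Line i ≡ Line j → i ≡ j
    line-size  : ∀ i → ∣ Line i ∣ ≡ 3
    two-points : ∀ (P Q : Point) → P ≢ Q →
                 Σ (Fin 7) λ i → (P ∈ Line i × Q ∈ Line i) ×
                   (∀ j → P ∈ Line j → Q ∈ Line j → j ≡ i)
open FanoPlane public

image : Permutation′ 7 → Subset 7 → Subset 7
image g D = tabulate (λ X → lookup D (g ⟨$⟩ˡ X))

-- composition with the convention (g · h)(P) = g (h P)
_·_ : Permutation′ 7 → Permutation′ 7 → Permutation′ 7
g · h = h ∘ₚ g

record Aut (F : FanoPlane) : Set where
  field
    perm     : Permutation′ 7
    preserve : ∀ i → ∃ λ j → image perm (Line F i) ≡ Line F j
open Aut public

iter : ℕ → Permutation′ 7 → Point → Point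
iter zero    g P = P
iter (suc n) g P = g ⟨$⟩ʳ iter n g P

record Orientation (F : FanoPlane) : Set where
  field
    aut      : Aut F
    pow7     : ∀ P → iter 7 (perm aut) P ≡ P
    nontriv  : ∃ λ P → perm aut ⟨$⟩ʳ P ≢ P
open Orientation public

-- exponent i with τ^i(P₀) = R (for an orientation such i exists)
dlog : Permutation′ 7 → Point → Point → Fin 7
dlog τ P₀ R with any? (λ i → iter (toℕ i) τ P₀ ≟ R)
... | yes (i , _) = i
... | no _        = fzero

residueSign : ℕ → Sign
residueSign 1 = pos
residueSign 2 = pos
residueSign 4 = pos
residueSign _ = neg

-- canonical composition factor ε^τ (built from base point P₀);
-- only meaningful for R ≢ S
epsilon : Permutation′ 7 → Point → Point → Point → Sign
epsilon τ P₀ R S =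
  residueSign ((toℕ (dlog τ P₀ S) + 7 ∸ toℕ (dlog τ P₀ R)) % 7)

-- I_ε : g · ε = ε, i.e. ε_{g⁻¹P g⁻¹Q} = ε_{PQ} for all distinct P, Q
Invariant : (Point → Point → Sign) → Permutation′ 7 → Set
Invariant ε g = ∀ P Q → P ≢ Q → ε (g ⟨$⟩ˡ P) (g ⟨$⟩ˡ Q) ≡ ε P Q

pointsOf : Subset 7 → List Point
pointsOf D = filterᵇ (lookup D) (allFin 7)

deltaStar : (Point → Point → Sign) → Permutation′ 7 → Subset 7 → Sign
deltaStar ε g D with pointsOf D
... | P ∷ Q ∷ _ = ε P Q * ε (g ⟨$⟩ʳ P) (g ⟨$⟩ʳ Q)
... | _         = pos

-- Only the second half of (2) needs more than g preserving ε, through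
-- δ*(g, D) = ε_PQ ε_{gP gQ}: it evaluates δ*(h, g(D)) at the pair gP, gQ, so it
-- needs δ* to be independent of the chosen pair.  Writing R = τⁱ(P₀) and
-- S = τʲ(P₀), ε_RS is the quadratic character of j − i mod 7, antisymmetric
-- since −1 is a non-residue.  No line contains points with coordinates i, i + d,
-- i + 2d (d ≠ 0): the line would contain a pair and its image under τᵈ, so it
-- would be τᵈ-stable, hence τ-stable, hence everything.  This makes ε constant
-- along the cyclic order of each line, so on a line ε_XY = ±ε_PQ with the sign
-- given by the cyclic orientation of (X, Y); an automorphism transports that
-- orientation, so ε_XY ε_{hX hY} is the same for every pair.
module Submission where

open import Defs
open import Data.Fin using (Fin)
open import Data.Sign using (Sign; +)
open import Data.Product using (_×_)

open import Data.Nat as ℕ using (ℕ; zero; suc; _∸_; _%_; _/_; _<_)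
open import Data.Nat.Properties using (+-comm; m+[n∸m]≡n; m∸n≤m; ≤-<-trans; m∸n≡0⇒m≤n; <⇒≤; <⇒≱; *-identityʳ; n<1+n)
open import Data.Nat.DivMod using (m≡m%n+[m/n]*n)
open import Data.Fin using (toℕ; fromℕ<; punchOut) renaming (zero to fzero; suc to fsuc)
open import Data.Fin.Properties
  using (any?; all?; _≟_; pigeonhole; punchOut-injective; toℕ<n; toℕ-fromℕ<)
open import Data.Fin.Subset using (Subset; _∈_; ∣_∣; ⊤)
open import Data.Fin.Subset.Properties using (_∈?_; anySubset?; ⊆-antisym; ⊆⊤; ∣⊤∣≡n)
open import Data.Fin.Permutation using (Permutation′; _⟨$⟩ʳ_; _⟨$⟩ˡ_; inverseˡ)
open import Data.Vec.Properties using (lookup∘tabulate; []=⇒lookup; lookup⇒[]=)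
open import Data.List using (_∷_)
import Data.List.Properties as ListP
import Data.List as List
open import Data.Vec using (lookup)
open import Data.Bool using (true)
open import Data.Sign using (-; opposite; _*_) renaming (_≟_ to _≟ₛ_)
open import Data.Sign.Properties using (s*s≡+)
open import Data.Product using (Σ; ∃; Σ-syntax; _,_; proj₁; proj₂)
open import Data.Sum using (_⊎_; inj₁; inj₂; [_,_]′)
open import Data.Empty using (⊥; ⊥-elim)
open import Function using (_∘_; id)
open import Relation.Binary.PropositionalEquality
  using (_≡_; _≢_; refl; sym; trans; cong; cong₂; subst; module ≡-Reasoning)
open import Relation.Nullary using (Dec; yes; no; ¬_; ¬?; contradiction)
open import Relation.Nullary.Decidable
  using (toWitness; decidable-stable; _×-dec_; _⊎-dec_; _→-dec_)
open import Relation.Unary using (Pred; Decidable)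

[s*a]*[s*b]≡a*b : ∀ s a b → (s * a) * (s * b) ≡ a * b
[s*a]*[s*b]≡a*b + a b = refl
[s*a]*[s*b]≡a*b - + + = refl
[s*a]*[s*b]≡a*b - + - = refl
[s*a]*[s*b]≡a*b - - + = refl
[s*a]*[s*b]≡a*b - - - = refl

cyclicOrientation : Fin 3 → Fin 3 → Sign
cyclicOrientation fzero        (fsuc fzero)        = +
cyclicOrientation (fsuc fzero) (fsuc (fsuc fzero)) = +
cyclicOrientation (fsuc (fsuc fzero)) fzero        = +
cyclicOrientation _ _                              = -

cyclic-sign : (s : Fin 3 → Fin 3 → Sign) →
  s fzero (fsuc fzero) ≡ s (fsuc fzero) (fsuc (fsuc fzero)) →
  s (fsuc fzero) (fsuc (fsuc fzero)) ≡ s (fsuc (fsuc fzero)) fzero →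
  (∀ u v → u ≢ v → s v u ≡ opposite (s u v)) →
  ∀ u v → u ≢ v → s u v ≡ cyclicOrientation u v * s fzero (fsuc fzero)
cyclic-sign s s₀₁≡s₁₂ s₁₂≡s₂₀ anti = go
  where
  s₀₁≡s₂₀ = trans s₀₁≡s₁₂ s₁₂≡s₂₀
  go : ∀ u v → u ≢ v → s u v ≡ cyclicOrientation u v * s fzero (fsuc fzero)
  go fzero fzero u≢v = contradiction refl u≢v
  go fzero (fsuc fzero) _ = refl
  go fzero (fsuc (fsuc fzero)) _ = trans (anti _ _ (λ ())) (cong opposite (sym s₀₁≡s₂₀))
  go (fsuc fzero) fzero _ = anti _ _ (λ ())
  go (fsuc fzero) (fsuc fzero) u≢v = contradiction refl u≢v
  go (fsuc fzero) (fsuc (fsuc fzero)) _ = sym s₀₁≡s₁₂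
  go (fsuc (fsuc fzero)) fzero _ = sym s₀₁≡s₂₀
  go (fsuc (fsuc fzero)) (fsuc fzero) _ = trans (anti _ _ (λ ())) (cong opposite (sym s₀₁≡s₁₂))
  go (fsuc (fsuc fzero)) (fsuc (fsuc fzero)) u≢v = contradiction refl u≢v

diffSign : Fin 7 → Fin 7 → Sign
diffSign x y = residueSign ((toℕ y ℕ.+ 7 ∸ toℕ x) % 7)

Progression : Fin 7 → Fin 7 → Fin 7 → Set
Progression a b c = Σ[ d ∈ Fin 7 ] d ≢ fzero × (toℕ d ℕ.+ toℕ a) % 7 ≡ toℕ b × (toℕ d ℕ.+ toℕ b) % 7 ≡ toℕ c

progression? : ∀ a b c → Dec (Progression a b c)
progression? a b c = any? λ d →
  ¬? (d ≟ fzero) ×-dec ((toℕ d ℕ.+ toℕ a) % 7 ℕ.≟ toℕ b) ×-dec ((toℕ d ℕ.+ toℕ b) % 7 ℕ.≟ toℕ c)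

diffSign-antisym : ∀ x y → x ≢ y → diffSign y x ≡ opposite (diffSign x y)
diffSign-antisym = toWitness {a? = all? λ x → all? λ y →
  ¬? (x ≟ y) →-dec (diffSign y x ≟ₛ opposite (diffSign x y))} _

-- With a = y − x and b = z − y, unequal signs mean that b/a is a
-- non-residue other than −1, i.e. a = −2b or b = −2a: then y, z, x or
-- z, x, y is an arithmetic progression.
diffSign-cyclic⊎progression : ∀ x y z → x ≢ y → y ≢ z → z ≢ x →
  diffSign x y ≡ diffSign y z ⊎ Progression y z x ⊎ Progression z x y
diffSign-cyclic⊎progression = toWitness {a? = all? λ x → all? λ y → all? λ z →
  ¬? (x ≟ y) →-dec ¬? (y ≟ z) →-dec ¬? (z ≟ x) →-dec
  ((diffSign x y ≟ₛ diffSign y z) ⊎-dec progression? y z x ⊎-dec progression? z x y)} _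

inverse-mod7 : ∀ (d : Fin 7) → d ≢ fzero → Σ[ k ∈ Fin 7 ] (toℕ k ℕ.* toℕ d) % 7 ≡ 1
inverse-mod7 = toWitness {a? = all? λ d →
  ¬? (d ≟ fzero) →-dec any? λ k → (toℕ k ℕ.* toℕ d) % 7 ℕ.≟ 1} _

⟨$⟩ʳ-injective : ∀ (g : Permutation′ 7) {X Y} → g ⟨$⟩ʳ X ≡ g ⟨$⟩ʳ Y → X ≡ Y
⟨$⟩ʳ-injective g {X} {Y} gX≡gY = trans (sym (inverseˡ g)) (trans (cong (g ⟨$⟩ˡ_) gX≡gY) (inverseˡ g))

module Iterate (τ : Permutation′ 7) where

  τ^ : ℕ → Point → Point
  τ^ n = iter n τ

  τ^-+ : ∀ m n X → τ^ (m ℕ.+ n) X ≡ τ^ m (τ^ n X)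
  τ^-+ zero    n X = refl
  τ^-+ (suc m) n X = cong (τ ⟨$⟩ʳ_) (τ^-+ m n X)

  τ^-injective : ∀ n {X Y} → τ^ n X ≡ τ^ n Y → X ≡ Y
  τ^-injective zero    e = e
  τ^-injective (suc n) e = τ^-injective n (⟨$⟩ʳ-injective τ e)

  τ^-*-stable : ∀ {D : Subset 7} e → (∀ Z → Z ∈ D → τ^ e Z ∈ D) → ∀ k Z → Z ∈ D → τ^ (k ℕ.* e) Z ∈ D
  τ^-*-stable e stable zero    Z Z∈D = Z∈D
  τ^-*-stable e stable (suc k) Z Z∈D =
    subst (_∈ _) (sym (τ^-+ e (k ℕ.* e) Z)) (stable _ (τ^-*-stable e stable k Z Z∈D))

  τ^-stable : ∀ {D : Subset 7} → (∀ Z → Z ∈ D → τ ⟨$⟩ʳ Z ∈ D) → ∀ n Z → Z ∈ D → τ^ n Z ∈ D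
  τ^-stable stable n Z Z∈D = subst (λ m → τ^ m Z ∈ _) (*-identityʳ n) (τ^-*-stable 1 stable n Z Z∈D)

  τ^-*-fixed : ∀ e {X} → τ^ e X ≡ X → ∀ k → τ^ (k ℕ.* e) X ≡ X
  τ^-*-fixed e fixed zero    = refl
  τ^-*-fixed e fixed (suc k) = trans (τ^-+ e (k ℕ.* e) _) (trans (cong (τ^ e) (τ^-*-fixed e fixed k)) fixed)

  fixed-backward : ∀ n {X Y} → τ^ n X ≡ Y → τ ⟨$⟩ʳ Y ≡ Y → τ ⟨$⟩ʳ X ≡ X
  fixed-backward n {X} {Y} τⁿX≡Y fixed = τ^-injective n (begin
    τ^ n (τ ⟨$⟩ʳ X)  ≡⟨ τ^-+ n 1 X ⟨
    τ^ (n ℕ.+ 1) X   ≡⟨ cong (λ m → τ^ m X) (+-comm n 1) ⟩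
    τ ⟨$⟩ʳ τ^ n X    ≡⟨ cong (τ ⟨$⟩ʳ_) τⁿX≡Y ⟩
    τ ⟨$⟩ʳ Y         ≡⟨ fixed ⟩
    Y                ≡⟨ τⁿX≡Y ⟨
    τ^ n X           ∎)
    where open ≡-Reasoning

module OrderSeven (τ : Permutation′ 7) (τ⁷ : ∀ X → iter 7 τ X ≡ X) where

  open Iterate τ public

  τ^-% : ∀ n X → τ^ n X ≡ τ^ (n % 7) X
  τ^-% n X = begin
    τ^ n X                           ≡⟨ cong (λ m → τ^ m X) (m≡m%n+[m/n]*n n 7) ⟩
    τ^ (n % 7 ℕ.+ n / 7 ℕ.* 7) X     ≡⟨ τ^-+ (n % 7) _ X ⟩
    τ^ (n % 7) (τ^ (n / 7 ℕ.* 7) X)  ≡⟨ cong (τ^ (n % 7)) (τ^-*-fixed 7 (τ⁷ X) (n / 7)) ⟩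
    τ^ (n % 7) X                     ∎
    where open ≡-Reasoning

  τ^≡τ : ∀ n X → n % 7 ≡ 1 → τ^ n X ≡ τ ⟨$⟩ʳ X
  τ^≡τ n X n%7≡1 = trans (τ^-% n X) (cong (λ m → τ^ m X) n%7≡1)

  τ^-fixed⇒fixed : ∀ (d : Fin 7) → d ≢ fzero → ∀ {X} → τ^ (toℕ d) X ≡ X → τ ⟨$⟩ʳ X ≡ X
  τ^-fixed⇒fixed d d≢0 {X} fixed =
    let (k , kd≡1) = inverse-mod7 d d≢0 in
    trans (sym (τ^≡τ (toℕ k ℕ.* toℕ d) X kd≡1)) (τ^-*-fixed (toℕ d) fixed (toℕ k))

  collision⇒fixed : ∀ {i j : Fin 7} {X} → toℕ i < toℕ j → τ^ (toℕ i) X ≡ τ^ (toℕ j) X → τ ⟨$⟩ʳ X ≡ X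
  collision⇒fixed {i} {j} {X} i<j τⁱX≡τʲX = τ^-fixed⇒fixed d d≢0 τᵈX≡X
    where
    δ = toℕ j ∸ toℕ i
    d : Fin 7
    d = fromℕ< (≤-<-trans (m∸n≤m (toℕ j) (toℕ i)) (toℕ<n j))
    toℕd≡δ : toℕ d ≡ δ
    toℕd≡δ = toℕ-fromℕ< _
    d≢0 : d ≢ fzero
    d≢0 d≡0 = <⇒≱ i<j (m∸n≡0⇒m≤n (trans (sym toℕd≡δ) (cong toℕ d≡0)))
    τᵈX≡X : τ^ (toℕ d) X ≡ X
    τᵈX≡X = subst (λ m → τ^ m X ≡ X) (sym toℕd≡δ) (τ^-injective (toℕ i) (begin
      τ^ (toℕ i) (τ^ δ X)  ≡⟨ τ^-+ (toℕ i) δ X ⟨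
      τ^ (toℕ i ℕ.+ δ) X   ≡⟨ cong (λ m → τ^ m X) (m+[n∸m]≡n (<⇒≤ i<j)) ⟩
      τ^ (toℕ j) X         ≡⟨ τⁱX≡τʲX ⟨
      τ^ (toℕ i) X         ∎))
      where open ≡-Reasoning

  -- Seven iterates avoiding R would collide by the pigeonhole principle.
  orbit⊎fixed : ∀ X R → (Σ[ i ∈ Fin 7 ] τ^ (toℕ i) X ≡ R) ⊎ τ ⟨$⟩ʳ X ≡ X
  orbit⊎fixed X R with any? (λ i → τ^ (toℕ i) X ≟ R)
  ... | yes inOrbit = inj₁ inOrbit
  ... | no ∉orbit with pigeonhole (n<1+n 6) (λ i → punchOut (∉orbit ∘ (i ,_) ∘ sym))
  ...   | i , j , i<j , eq =
    inj₂ (collision⇒fixed i<j (punchOut-injective (∉orbit ∘ (i ,_) ∘ sym) (∉orbit ∘ (j ,_) ∘ sym) eq))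

module SevenCycle (τ : Permutation′ 7) (τ⁷ : ∀ X → iter 7 τ X ≡ X) (moved : ∃ λ Q → τ ⟨$⟩ʳ Q ≢ Q) where

  open OrderSeven τ τ⁷ public

  fixedPointFree : ∀ X → τ ⟨$⟩ʳ X ≢ X
  fixedPointFree X fixed with orbit⊎fixed (proj₁ moved) X
  ... | inj₁ (i , τⁱQ≡X) = proj₂ moved (fixed-backward (toℕ i) τⁱQ≡X fixed)
  ... | inj₂ τQ≡Q        = proj₂ moved τQ≡Q

  transitive : ∀ X Y → Σ[ i ∈ Fin 7 ] τ^ (toℕ i) X ≡ Y
  transitive X Y with orbit⊎fixed X Y
  ... | inj₁ inOrbit = inOrbit
  ... | inj₂ fixed   = contradiction fixed (fixedPointFree X)

  -- dlog τ P₀ R only computes once the seven tests τⁱ P₀ ≟ R inside any? are decided.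
  dlog-spec : ∀ P₀ R → τ^ (toℕ (dlog τ P₀ R)) P₀ ≡ R
  dlog-spec P₀ R
    with iter 0 τ P₀ ≟ R | iter 1 τ P₀ ≟ R | iter 2 τ P₀ ≟ R | iter 3 τ P₀ ≟ R
       | iter 4 τ P₀ ≟ R | iter 5 τ P₀ ≟ R | iter 6 τ P₀ ≟ R
  ... | yes e | _     | _     | _     | _     | _     | _     = e
  ... | no _  | yes e | _     | _     | _     | _     | _     = e
  ... | no _  | no _  | yes e | _     | _     | _     | _     = e
  ... | no _  | no _  | no _  | yes e | _     | _     | _     = e
  ... | no _  | no _  | no _  | no _  | yes e | _     | _     = e
  ... | no _  | no _  | no _  | no _  | no _  | yes e | _     = e
  ... | no _  | no _  | no _  | no _  | no _  | no _  | yes e = e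
  ... | no n₀ | no n₁ | no n₂ | no n₃ | no n₄ | no n₅ | no n₆ with transitive P₀ R
  ...   | fzero , e                                     = contradiction e n₀
  ...   | fsuc fzero , e                                = contradiction e n₁
  ...   | fsuc (fsuc fzero) , e                         = contradiction e n₂
  ...   | fsuc (fsuc (fsuc fzero)) , e                  = contradiction e n₃
  ...   | fsuc (fsuc (fsuc (fsuc fzero))) , e           = contradiction e n₄
  ...   | fsuc (fsuc (fsuc (fsuc (fsuc fzero)))) , e    = contradiction e n₅
  ...   | fsuc (fsuc (fsuc (fsuc (fsuc (fsuc fzero))))) , e = contradiction e n₆

∈-image : ∀ (g : Permutation′ 7) {D X} → X ∈ D → g ⟨$⟩ʳ X ∈ image g D
∈-image g {D} {X} X∈D = lookup⇒[]= (g ⟨$⟩ʳ X) (image g D) (begin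
  lookup (image g D) (g ⟨$⟩ʳ X) ≡⟨ lookup∘tabulate (λ Y → lookup D (g ⟨$⟩ˡ Y)) (g ⟨$⟩ʳ X) ⟩
  lookup D (g ⟨$⟩ˡ (g ⟨$⟩ʳ X))  ≡⟨ cong (lookup D) (inverseˡ g) ⟩
  lookup D X                    ≡⟨ []=⇒lookup X∈D ⟩
  true                          ∎)
  where open ≡-Reasoning

allSubsets? : ∀ {n} {ℓ} {P : Pred (Subset n) ℓ} → Decidable P → Dec (∀ p → P p)
allSubsets? P? with anySubset? (¬? ∘ P?)
... | yes (p , ¬Pp) = no λ all → ¬Pp (all p)
... | no ∄¬P        = yes λ p → decidable-stable (P? p) (∄¬P ∘ (p ,_))

IsListing : Subset 7 → (Fin 3 → Point) → Set
IsListing D pt = pointsOf D ≡ List.tabulate pt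
               × (∀ u v → pt u ≡ pt v → u ≡ v)
               × (∀ u → pt u ∈ D)
               × (∀ X → X ∈ D → ∃ λ u → pt u ≡ X)

isListing? : ∀ D pt → Dec (IsListing D pt)
isListing? D pt = ListP.≡-dec _≟_ (pointsOf D) (List.tabulate pt)
  ×-dec (all? λ u → all? λ v → (pt u ≟ pt v) →-dec (u ≟ v))
  ×-dec (all? λ u → pt u ∈? D)
  ×-dec (all? λ X → (X ∈? D) →-dec any? λ u → pt u ≟ X)

triple : Point → Point → Point → Fin 3 → Point
triple P Q R fzero               = P
triple P Q R (fsuc fzero)        = Q
triple P Q R (fsuc (fsuc fzero)) = R

-- Opaque, so that the exhaustive search is never re-evaluated during conversion checking.
opaque
  threePointSet-listedByTriple : ∀ D → ∣ D ∣ ≡ 3 → ∃ λ P → ∃ λ Q → ∃ λ R → IsListing D (triple P Q R)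
  threePointSet-listedByTriple = toWitness {a? = allSubsets? λ D → (∣ D ∣ ℕ.≟ 3) →-dec
    any? λ P → any? λ Q → any? λ R → isListing? D (triple P Q R)} _

listing : ∀ D → ∣ D ∣ ≡ 3 → Σ (Fin 3 → Point) (IsListing D)
listing D ∣D∣≡3 =
  let (P , Q , R , isListing) = threePointSet-listedByTriple D ∣D∣≡3 in triple P Q R , isListing

pairDelta : (Point → Point → Sign) → Permutation′ 7 → Point → Point → Sign
pairDelta ε g P Q = ε P Q * ε (g ⟨$⟩ʳ P) (g ⟨$⟩ʳ Q)

deltaStar-head : ∀ ε g D {P Q Ps} → pointsOf D ≡ P ∷ Q ∷ Ps → deltaStar ε g D ≡ pairDelta ε g P Q
deltaStar-head ε g D eq with pointsOf D | eq
... | _ | refl = refl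

Invariant⇒preserves : ∀ {ε} g → Invariant ε g → ∀ {X Y} → X ≢ Y → ε (g ⟨$⟩ʳ X) (g ⟨$⟩ʳ Y) ≡ ε X Y
Invariant⇒preserves {ε} g inv X≢Y =
  trans (sym (inv _ _ (X≢Y ∘ ⟨$⟩ʳ-injective g))) (cong₂ ε (inverseˡ g) (inverseˡ g))

pairDelta-invariant : ∀ {ε} g → Invariant ε g → ∀ {P Q} → P ≢ Q → pairDelta ε g P Q ≡ +
pairDelta-invariant {ε} g inv {P} {Q} P≢Q =
  trans (cong (ε P Q *_) (Invariant⇒preserves g inv P≢Q)) (s*s≡+ (ε P Q))

pairDelta-invariantˡ : ∀ {ε} g h → Invariant ε g → ∀ {P Q} → P ≢ Q → pairDelta ε (g · h) P Q ≡ pairDelta ε h P Q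
pairDelta-invariantˡ {ε} g h inv {P} {Q} P≢Q =
  cong (ε P Q *_) (Invariant⇒preserves g inv (P≢Q ∘ ⟨$⟩ʳ-injective h))

pairDelta-invariantʳ : ∀ {ε} g h → Invariant ε g → ∀ {P Q} → P ≢ Q →
  pairDelta ε (h · g) P Q ≡ pairDelta ε h (g ⟨$⟩ʳ P) (g ⟨$⟩ʳ Q)
pairDelta-invariantʳ {ε} g h inv {P} {Q} P≢Q =
  cong (_* ε (h ⟨$⟩ʳ (g ⟨$⟩ʳ P)) (h ⟨$⟩ʳ (g ⟨$⟩ʳ Q))) (sym (Invariant⇒preserves g inv P≢Q))

module Lines (F : FanoPlane) where

  MapsLines : (Point → Point) → Set
  MapsLines f = ∀ i → Σ[ j ∈ Fin 7 ] (∀ {X} → X ∈ Line F i → f X ∈ Line F j)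

  aut-mapsLines : (g : Aut F) → MapsLines (perm g ⟨$⟩ʳ_)
  aut-mapsLines g i = let (j , g[Lᵢ]≡Lⱼ) = preserve g i in j , subst (_ ∈_) g[Lᵢ]≡Lⱼ ∘ ∈-image (perm g)

  iter-mapsLines : (g : Aut F) → ∀ n → MapsLines (iter n (perm g))
  iter-mapsLines g zero    i = i , λ X∈Lᵢ → X∈Lᵢ
  iter-mapsLines g (suc n) i =
    let (j , gⁿ-maps) = iter-mapsLines g n i ; (k , g-maps) = aut-mapsLines g j in k , g-maps ∘ gⁿ-maps

  line-unique : ∀ {P Q} → P ≢ Q → ∀ {i j} →
    P ∈ Line F i → Q ∈ Line F i → P ∈ Line F j → Q ∈ Line F j → i ≡ j
  line-unique P≢Q P∈Lᵢ Q∈Lᵢ P∈Lⱼ Q∈Lⱼ =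
    let (_ , _ , unique) = two-points F _ _ P≢Q in trans (unique _ P∈Lᵢ Q∈Lᵢ) (sym (unique _ P∈Lⱼ Q∈Lⱼ))

  line-not-full : ∀ i → ¬ (∀ X → X ∈ Line F i)
  line-not-full i full = 3≢7 (begin
    3              ≡⟨ line-size F i ⟨
    ∣ Line F i ∣   ≡⟨ cong ∣_∣ (⊆-antisym ⊆⊤ (λ {X} _ → full X)) ⟩
    ∣ ⊤ {7} ∣      ≡⟨ ∣⊤∣≡n 7 ⟩
    7              ∎)
    where
    open ≡-Reasoning
    3≢7 : 3 ≢ 7
    3≢7 ()

  line-basePair : ∀ i → Σ[ P ∈ Point ] Σ[ Q ∈ Point ] P ≢ Q × P ∈ Line F i × Q ∈ Line F i ×
    (∀ ε g → deltaStar ε g (Line F i) ≡ pairDelta ε g P Q)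
  line-basePair i =
    let (pt , pointsOf≡ , pt-injective , pt∈Lᵢ , _) = listing (Line F i) (line-size F i) in
    pt fzero , pt (fsuc fzero) , (λ ()) ∘ pt-injective fzero (fsuc fzero) , pt∈Lᵢ fzero , pt∈Lᵢ (fsuc fzero) ,
    λ ε g → deltaStar-head ε g (Line F i) pointsOf≡

  deltaStar-invariant : ∀ {ε} g → Invariant ε g → ∀ i → deltaStar ε g (Line F i) ≡ +
  deltaStar-invariant g inv i =
    let (_ , _ , P≢Q , _ , _ , head) = line-basePair i in
    trans (head _ g) (pairDelta-invariant g inv P≢Q)

  deltaStar-invariantˡ : ∀ {ε} g h → Invariant ε g → ∀ i →
    deltaStar ε (g · h) (Line F i) ≡ deltaStar ε h (Line F i)
  deltaStar-invariantˡ g h inv i =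
    let (_ , _ , P≢Q , _ , _ , head) = line-basePair i in
    trans (head _ (g · h)) (trans (pairDelta-invariantˡ g h inv P≢Q) (sym (head _ h)))

module CyclicSign (F : FanoPlane) (ε : Point → Point → Sign)
  (ε-antisym : ∀ {X Y} → X ≢ Y → ε Y X ≡ opposite (ε X Y))
  (ε-cyclic : ∀ {i X Y Z} → X ∈ Line F i → Y ∈ Line F i → Z ∈ Line F i →
              X ≢ Y → Y ≢ Z → Z ≢ X → ε X Y ≡ ε Y Z) where

  open Lines F

  ε-onTriangle : ∀ {i} (pt : Fin 3 → Point) → (∀ u v → pt u ≡ pt v → u ≡ v) → (∀ u → pt u ∈ Line F i) →
    ∀ u v → u ≢ v → ε (pt u) (pt v) ≡ cyclicOrientation u v * ε (pt fzero) (pt (fsuc fzero))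
  ε-onTriangle pt pt-injective pt∈Lᵢ = cyclic-sign (λ u v → ε (pt u) (pt v))
    (ε-cyclic (pt∈Lᵢ _) (pt∈Lᵢ _) (pt∈Lᵢ _) (distinct _ _ λ ()) (distinct _ _ λ ()) (distinct _ _ λ ()))
    (ε-cyclic (pt∈Lᵢ _) (pt∈Lᵢ _) (pt∈Lᵢ _) (distinct _ _ λ ()) (distinct _ _ λ ()) (distinct _ _ λ ()))
    (λ u v u≢v → ε-antisym (distinct u v u≢v))
    where
    distinct : ∀ u v → u ≢ v → pt u ≢ pt v
    distinct u v u≢v = u≢v ∘ pt-injective u v

  pairDelta-onTriangle : (h : Aut F) → ∀ {i} (pt : Fin 3 → Point) → (∀ u v → pt u ≡ pt v → u ≡ v) →
    (∀ u → pt u ∈ Line F i) → ∀ u v → u ≢ v →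
    pairDelta ε (perm h) (pt u) (pt v) ≡ pairDelta ε (perm h) (pt fzero) (pt (fsuc fzero))
  pairDelta-onTriangle h {i} pt pt-injective pt∈Lᵢ u v u≢v = begin
    ε (pt u) (pt v) * ε (hpt u) (hpt v)
      ≡⟨ cong₂ _*_ (ε-onTriangle pt pt-injective pt∈Lᵢ u v u≢v)
                   (ε-onTriangle hpt hpt-injective (h-maps ∘ pt∈Lᵢ) u v u≢v) ⟩
    (cyclicOrientation u v * ε (pt fzero) (pt (fsuc fzero))) * (cyclicOrientation u v * ε (hpt fzero) (hpt (fsuc fzero)))
      ≡⟨ [s*a]*[s*b]≡a*b (cyclicOrientation u v) _ _ ⟩
    ε (pt fzero) (pt (fsuc fzero)) * ε (hpt fzero) (hpt (fsuc fzero)) ∎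
    where
    open ≡-Reasoning
    hpt : Fin 3 → Point
    hpt = (perm h ⟨$⟩ʳ_) ∘ pt
    hpt-injective : ∀ u v → hpt u ≡ hpt v → u ≡ v
    hpt-injective u v = pt-injective u v ∘ ⟨$⟩ʳ-injective (perm h)
    h-maps = proj₂ (aut-mapsLines h i)

  deltaStar-anyPair : (h : Aut F) → ∀ j {X Y} → X ∈ Line F j → Y ∈ Line F j → X ≢ Y →
    deltaStar ε (perm h) (Line F j) ≡ pairDelta ε (perm h) X Y
  deltaStar-anyPair h j {X} {Y} X∈Lⱼ Y∈Lⱼ X≢Y =
    let (pt , pointsOf≡ , pt-injective , pt∈Lⱼ , cover) = listing (Line F j) (line-size F j)
        (u , ptu≡X) = cover X X∈Lⱼ
        (v , ptv≡Y) = cover Y Y∈Lⱼ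
        u≢v : u ≢ v
        u≢v u≡v = X≢Y (trans (sym ptu≡X) (trans (cong pt u≡v) ptv≡Y))
    in begin
    deltaStar ε (perm h) (Line F j)                         ≡⟨ deltaStar-head ε (perm h) (Line F j) pointsOf≡ ⟩
    pairDelta ε (perm h) (pt fzero) (pt (fsuc fzero))       ≡⟨ pairDelta-onTriangle h pt pt-injective pt∈Lⱼ u v u≢v ⟨
    pairDelta ε (perm h) (pt u) (pt v)                      ≡⟨ cong₂ (pairDelta ε (perm h)) ptu≡X ptv≡Y ⟩
    pairDelta ε (perm h) X Y                                ∎
    where open ≡-Reasoning

  deltaStar-invariantʳ : (g h : Aut F) → Invariant ε (perm g) → ∀ i →
    deltaStar ε (perm h · perm g) (Line F i) ≡ deltaStar ε (perm h) (image (perm g) (Line F i))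
  deltaStar-invariantʳ g h inv i =
    let (P , Q , P≢Q , P∈Lᵢ , Q∈Lᵢ , head) = line-basePair i
        (j , g[Lᵢ]≡Lⱼ) = preserve g i
        g[Lᵢ]⊆Lⱼ : ∀ {X} → X ∈ Line F i → perm g ⟨$⟩ʳ X ∈ Line F j
        g[Lᵢ]⊆Lⱼ = subst (_ ∈_) g[Lᵢ]≡Lⱼ ∘ ∈-image (perm g)
    in begin
    deltaStar ε (perm h · perm g) (Line F i)              ≡⟨ head ε _ ⟩
    pairDelta ε (perm h · perm g) P Q                      ≡⟨ pairDelta-invariantʳ (perm g) (perm h) inv P≢Q ⟩
    pairDelta ε (perm h) (perm g ⟨$⟩ʳ P) (perm g ⟨$⟩ʳ Q)  ≡⟨ deltaStar-anyPair h j (g[Lᵢ]⊆Lⱼ P∈Lᵢ) (g[Lᵢ]⊆Lⱼ Q∈Lᵢ)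
                                                               (P≢Q ∘ ⟨$⟩ʳ-injective (perm g)) ⟨
    deltaStar ε (perm h) (Line F j)                        ≡⟨ cong (deltaStar ε (perm h)) g[Lᵢ]≡Lⱼ ⟨
    deltaStar ε (perm h) (image (perm g) (Line F i))       ∎
    where open ≡-Reasoning

module Oriented (F : FanoPlane) (O : Orientation F) (P₀ : Point) where

  open Lines F

  τ : Permutation′ 7
  τ = perm (aut O)

  open SevenCycle τ (pow7 O) (nontriv O)

  ε : Point → Point → Sign
  ε = epsilon τ P₀

  coord : Point → Fin 7
  coord = dlog τ P₀

  coord-injective : ∀ {X Y} → coord X ≡ coord Y → X ≡ Y
  coord-injective {X} {Y} eq = trans (sym (dlog-spec P₀ X)) (trans (cong (λ i → τ^ (toℕ i) P₀) eq) (dlog-spec P₀ Y))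

  τ^-coord : ∀ (d : Fin 7) X Y → (toℕ d ℕ.+ toℕ (coord X)) % 7 ≡ toℕ (coord Y) → τ^ (toℕ d) X ≡ Y
  τ^-coord d X Y d+cX≡cY = begin
    τ^ (toℕ d) X                          ≡⟨ cong (τ^ (toℕ d)) (dlog-spec P₀ X) ⟨
    τ^ (toℕ d) (τ^ (toℕ (coord X)) P₀)    ≡⟨ τ^-+ (toℕ d) (toℕ (coord X)) P₀ ⟨
    τ^ (toℕ d ℕ.+ toℕ (coord X)) P₀       ≡⟨ τ^-% (toℕ d ℕ.+ toℕ (coord X)) P₀ ⟩
    τ^ ((toℕ d ℕ.+ toℕ (coord X)) % 7) P₀ ≡⟨ cong (λ m → τ^ m P₀) d+cX≡cY ⟩
    τ^ (toℕ (coord Y)) P₀                 ≡⟨ dlog-spec P₀ Y ⟩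
    Y                                     ∎
    where open ≡-Reasoning

  -- The line would be stable under τ^d, hence under τ = τ^(kd) for kd ≡ 1,
  -- hence contain the whole orbit of X, which is every point.
  no-translated-pair : ∀ i (d : Fin 7) → d ≢ fzero → ∀ {X Y} → X ≢ Y →
    X ∈ Line F i → Y ∈ Line F i → τ^ (toℕ d) X ∈ Line F i → τ^ (toℕ d) Y ∈ Line F i → ⊥
  no-translated-pair i d d≢0 {X} {Y} X≢Y X∈Lᵢ Y∈Lᵢ τᵈX∈Lᵢ τᵈY∈Lᵢ
    with j , τᵈ-maps ← iter-mapsLines (aut O) (toℕ d) i =
    line-not-full i λ Z → let (n , τⁿX≡Z) = transitive X Z in subst (_∈ Line F i) τⁿX≡Z (τ^-stable τ-stable (toℕ n) X X∈Lᵢ)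
    where
    j≡i : j ≡ i
    j≡i = line-unique (X≢Y ∘ τ^-injective (toℕ d)) (τᵈ-maps X∈Lᵢ) (τᵈ-maps Y∈Lᵢ) τᵈX∈Lᵢ τᵈY∈Lᵢ
    τᵈ-stable : ∀ Z → Z ∈ Line F i → τ^ (toℕ d) Z ∈ Line F i
    τᵈ-stable Z Z∈Lᵢ = subst (λ k → _ ∈ Line F k) j≡i (τᵈ-maps Z∈Lᵢ)
    τ-stable : ∀ Z → Z ∈ Line F i → τ ⟨$⟩ʳ Z ∈ Line F i
    τ-stable Z Z∈Lᵢ = let (k , kd≡1) = inverse-mod7 d d≢0 in
      subst (_∈ Line F i) (τ^≡τ (toℕ k ℕ.* toℕ d) Z kd≡1) (τ^-*-stable (toℕ d) τᵈ-stable (toℕ k) Z Z∈Lᵢ)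

  no-progression-on-line : ∀ {i X Y Z} → X ∈ Line F i → Y ∈ Line F i → Z ∈ Line F i → X ≢ Y →
    ¬ Progression (coord X) (coord Y) (coord Z)
  no-progression-on-line {i} {X} {Y} {Z} X∈Lᵢ Y∈Lᵢ Z∈Lᵢ X≢Y (d , d≢0 , dX≡Y , dY≡Z) =
    no-translated-pair i d d≢0 X≢Y X∈Lᵢ Y∈Lᵢ
      (subst (_∈ Line F i) (sym (τ^-coord d X Y dX≡Y)) Y∈Lᵢ)
      (subst (_∈ Line F i) (sym (τ^-coord d Y Z dY≡Z)) Z∈Lᵢ)

  ε-antisym : ∀ {X Y} → X ≢ Y → ε Y X ≡ opposite (ε X Y)
  ε-antisym {X} {Y} X≢Y = diffSign-antisym (coord X) (coord Y) (X≢Y ∘ coord-injective)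

  ε-cyclic : ∀ {i X Y Z} → X ∈ Line F i → Y ∈ Line F i → Z ∈ Line F i →
    X ≢ Y → Y ≢ Z → Z ≢ X → ε X Y ≡ ε Y Z
  ε-cyclic {X = X} {Y} {Z} X∈Lᵢ Y∈Lᵢ Z∈Lᵢ X≢Y Y≢Z Z≢X =
    [ id
    , [ ⊥-elim ∘ no-progression-on-line Y∈Lᵢ Z∈Lᵢ X∈Lᵢ Y≢Z
      , ⊥-elim ∘ no-progression-on-line Z∈Lᵢ X∈Lᵢ Y∈Lᵢ Z≢X ]′ ]′
    (diffSign-cyclic⊎progression (coord X) (coord Y) (coord Z)
      (X≢Y ∘ coord-injective) (Y≢Z ∘ coord-injective) (Z≢X ∘ coord-injective))

  open CyclicSign F ε ε-antisym ε-cyclic public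

proposition2p33 : (F : FanoPlane) (τ : Orientation F) (P₀ : Fin 7) →
    ((g : Aut F) → Invariant (epsilon (perm (aut τ)) P₀) (perm g) →
      ∀ i → deltaStar (epsilon (perm (aut τ)) P₀) (perm g) (Line F i) ≡ +)
    ×
    ((g h : Aut F) → Invariant (epsilon (perm (aut τ)) P₀) (perm g) →
      ∀ i →
        (deltaStar (epsilon (perm (aut τ)) P₀) (perm g · perm h) (Line F i)
          ≡ deltaStar (epsilon (perm (aut τ)) P₀) (perm h) (Line F i))
        ×
        (deltaStar (epsilon (perm (aut τ)) P₀) (perm h · perm g) (Line F i)
          ≡ deltaStar (epsilon (perm (aut τ)) P₀) (perm h) (image (perm g) (Line F i))))
proposition2p33 F τ P₀ =
    (λ g → deltaStar-invariant (perm g))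
  , (λ g h inv i → deltaStar-invariantˡ (perm g) (perm h) inv i , deltaStar-invariantʳ g h inv i)
  where
  open Lines F
  open Oriented F τ P₀ using (deltaStar-invariantʳ)
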